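{- Let $n,k$ be positive integers with $2\le k\le\left\lfloor\frac{n}{2}\right\rfloor$. Then there is a connected graph $G$ of order $n(G)=n$ such that $$\left\lceil\frac{n(G)}{\mu(G)}\right\rceil\le\chi_\mu(G)=k\le\left\lfloor\frac{n(G)}{2}\right\rfloor.$$
   Context: For a connected graph $G$ and $S\subseteq V(G)$, two vertices $x,y\in S$ are $S$-visible if there is a shortest $x,y$-path $P$ in $G$ with $V(P)\cap S=\{x,y\}$. $S$ is a mutual-visibility set if any two vertices of $S$ are $S$-visible. The mutual-visibility number $\mu(G)$ is the largest cardinality of a mutual-visibility set. A mutual-visibility coloring of $G$ is a partition of $V(G)$ into mutual-visibility sets, and the mutual-visibility chromatic number $\chi_\mu(G)$ is the smallest number of classes in such a partition. -}

module Defs where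

open import Data.Nat using (ℕ; zero; suc; _+_; _*_; _∸_; _≤_; _<_; _/_)
open import Data.Fin using (Fin)
open import Data.Fin.Subset using (Subset; _∈_; ∣_∣)
open import Data.Bool using (Bool; true; false; T)
open import Data.List using (List; []; _∷_; length)
open import Data.List.Membership.Propositional renaming (_∈_ to _∈ₗ_)
open import Data.Product using (Σ; ∃; ∃-syntax; _×_; _,_)
open import Data.Sum using (_⊎_)
open import Data.Empty using (⊥)
open import Relation.Nullary using (¬_)
open import Relation.Binary.PropositionalEquality using (_≡_)
open import Function using (Surjective)

record Graph (n : ℕ) : Set where
  field
    adj   : Fin n → Fin n → Bool
    sym   : ∀ x y → adj x y ≡ adj y x
    irrefl : ∀ x → adj x x ≡ false

open Graph public

module _ {n : ℕ} (G : Graph n) where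

  Adj : Fin n → Fin n → Set
  Adj x y = T (adj G x y)

  data Walk : Fin n → Fin n → Set where
    [_]  : (x : Fin n) → Walk x x
    _∷ᵂ_ : ∀ {x y z} → Adj x y → Walk y z → Walk x z

  walkLength : ∀ {x y} → Walk x y → ℕ
  walkLength [ x ]     = 0
  walkLength (_ ∷ᵂ w) = suc (walkLength w)

  vertices : ∀ {x y} → Walk x y → List (Fin n)
  vertices [ x ]                 = x ∷ []
  vertices (_∷ᵂ_ {x = x} _ w) = x ∷ vertices w

  Connected : Set
  Connected = ∀ x y → Walk x y

  -- A shortest x,y-path: a walk from x to y of minimum length
  -- (a minimum-length walk never repeats vertices, so it is a path).
  Shortest : ∀ {x y} → Walk x y → Set
  Shortest {x} {y} P = ∀ (Q : Walk x y) → walkLength P ≤ walkLength Q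

  SVisible : Subset n → Fin n → Fin n → Set
  SVisible S x y =
    Σ (Walk x y) λ P → Shortest P ×
      (∀ v → v ∈ₗ vertices P → v ∈ S → (v ≡ x ⊎ v ≡ y))

  IsMutualVisibilitySet : Subset n → Set
  IsMutualVisibilitySet S = ∀ x y → x ∈ S → y ∈ S → SVisible S x y

  IsMu : ℕ → Set
  IsMu m = (Σ (Subset n) λ S → IsMutualVisibilitySet S × ∣ S ∣ ≡ m)
         × (∀ S → IsMutualVisibilitySet S → ∣ S ∣ ≤ m)

  colourClass : ∀ {j} → (Fin n → Fin j) → Fin j → Subset n
  colourClass c i = Data.Vec.tabulate λ v → ⌊ c v Data.Fin.≟ i ⌋
    where
      open import Data.Vec
      open import Relation.Nullary.Decidable using (⌊_⌋)
      import Data.Fin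

  IsMVColouring : ∀ {j} → (Fin n → Fin j) → Set
  IsMVColouring {j} c = ∀ (i : Fin j) → IsMutualVisibilitySet (colourClass c i)

  IsChiMu : ℕ → Set
  IsChiMu k = (Σ (Fin n → Fin k) λ c → Surjective _≡_ _≡_ c × IsMVColouring c)
            × (∀ j → j < k → (c : Fin n → Fin j) → ¬ IsMVColouring c)

-- Ceiling division ⌈a / b⌉ (b = 0 is given the junk value 0; it is never
-- used, as μ(G) ≥ 1 for every graph of positive order).
⌈_/_⌉ : ℕ → ℕ → ℕ
⌈ a / zero ⌉  = 0
⌈ a / suc b ⌉ = (a + b) / suc b

module Submission where

-- Take a path a₀ — ⋯ — a₂ₖ₋₂ whose last vertex is joined to every vertex of a clique K_t,
-- t = n − 2k + 1, and give aᵢ height i and the clique vertices height 2k − 1. Heights change by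
-- at most one along an edge, so every walk meets all intermediate levels; since the levels below
-- the top are single vertices, no mutual-visibility set contains three vertices of strictly
-- increasing height. Hence μ = t + 1, attained by the clique on the two top levels, and a colouring
-- with fewer than k colours puts three of the 2k vertices of heights 0, …, 2k − 1 into one class,
-- whereas colouring by ⌊height / 2⌋ has exactly k classes, each of them a clique.

open import Defs hiding (sym)
open import Data.Nat using (ℕ; zero; suc; _+_; _*_; _≤_; _<_; _⊓_; z≤n; s≤s; s≤s⁻¹; z<s; s<s; ⌊_/2⌋)
open import Data.Nat.Properties
open import Data.Nat.DivMod using (m<n*o⇒m/o<n)
open import Data.Fin as Fin using (Fin; toℕ; fromℕ<; combine; _↑ˡ_; _↑ʳ_)
import Data.Fin.Properties as Finₚ
open import Data.Fin.Subset using (Subset; _∈_; ∣_∣; inside; outside; ⊤; Empty)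
open import Data.Fin.Subset.Properties using (nonempty?; Empty-unique; ∣⊥∣≡0; ∣⊤∣≡n; ∣p∣≤n)
open import Data.Vec as Vec using ([]; _∷_; _++_; here; there)
open import Data.Vec.Properties using ([]=⇒lookup; lookup⇒[]=; lookup∘tabulate; lookup-++ˡ; lookup-++ʳ)
open import Data.Bool using (T)
open import Data.List.Relation.Unary.Any using (here; there)
open import Data.List.Membership.Propositional renaming (_∈_ to _∈ₗ_)
open import Data.Product using (Σ; ∃; _×_; _,_; proj₂)
open import Data.Sum using (inj₁; inj₂)
open import Data.Empty using (⊥; ⊥-elim)
open import Function using (_∘_; mk⇔; Surjective)
open import Relation.Nullary using (¬_; Dec; yes; no; does; contradiction)
open import Relation.Nullary.Decidable using (_×-dec_; ¬?; does-⇔; dec-false; dec-true; isYes≗does)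
open import Relation.Binary.PropositionalEquality

module _ {n : ℕ} (G : Graph n) where

  Adj-sym : ∀ {x y} → Adj G x y → Adj G y x
  Adj-sym {x} {y} = subst T (Graph.sym G x y)

  _++ᵂ_ : ∀ {x y z} → Walk G x y → Walk G y z → Walk G x z
  [ _ ]    ++ᵂ Q = Q
  (a ∷ᵂ P) ++ᵂ Q = a ∷ᵂ (P ++ᵂ Q)

  reverseOnto : ∀ {x y z} → Walk G x y → Walk G x z → Walk G y z
  reverseOnto [ _ ]    acc = acc
  reverseOnto (a ∷ᵂ P) acc = reverseOnto P (Adj-sym a ∷ᵂ acc)

  reverseᵂ : ∀ {x y} → Walk G x y → Walk G y x
  reverseᵂ {x} P = reverseOnto P [ x ]

  reachAll⇒Connected : ∀ r → (∀ x → Walk G x r) → Connected G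
  reachAll⇒Connected r toRoot x y = toRoot x ++ᵂ reverseᵂ (toRoot y)

  edge-shortest : ∀ {x y} (a : Adj G x y) → Shortest G (a ∷ᵂ [ y ])
  edge-shortest {x} a [ _ ]    = ⊥-elim (subst T (irrefl G x) a)
  edge-shortest     a (_ ∷ᵂ _) = s≤s z≤n

  Clique : Subset n → Set
  Clique S = ∀ {x y} → x ∈ S → y ∈ S → x ≢ y → Adj G x y

  clique⇒mutualVisibility : ∀ {S} → Clique S → IsMutualVisibilitySet G S
  clique⇒mutualVisibility clique x y x∈S y∈S with x Finₚ.≟ y
  ... | yes refl = [ x ] , (λ _ → z≤n) , λ { _ (here refl) _ → inj₁ refl }
  ... | no x≢y   = (a ∷ᵂ [ y ]) , edge-shortest a , λ
    { _ (here refl)         _ → inj₁ refl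
    ; _ (there (here refl)) _ → inj₂ refl }
    where a = clique x∈S y∈S x≢y

  ⇒∈colourClass : ∀ {j} (c : Fin n → Fin j) {i v} → c v ≡ i → v ∈ colourClass G c i
  ⇒∈colourClass c {i} {v} cv≡i = lookup⇒[]= v _
    (trans (lookup∘tabulate _ v) (trans (isYes≗does (c v Finₚ.≟ i)) (dec-true (c v Finₚ.≟ i) cv≡i)))

  ∈colourClass⇒ : ∀ {j} (c : Fin n → Fin j) {i v} → v ∈ colourClass G c i → c v ≡ i
  ∈colourClass⇒ c {i} {v} v∈class
    with c v Finₚ.≟ i | trans (sym (lookup∘tabulate _ v)) ([]=⇒lookup v∈class)
  ... | yes cv≡i | _ = cv≡i
  ... | no  _    | ()

  module _ (h : Fin n → ℕ) (h-step : ∀ {u v} → Adj G u v → h v ≤ suc (h u)) where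

    walk-crosses-level : ∀ {x z} (P : Walk G x z) {b} → h x ≤ b → b ≤ h z →
                         ∃ λ v → v ∈ₗ vertices G P × h v ≡ b
    walk-crosses-level [ x ] hx≤b b≤hz = x , here refl , ≤-antisym hx≤b b≤hz
    walk-crosses-level (_∷ᵂ_ {x} a P) {b} hx≤b b≤hz with h x ≟ b
    ... | yes hx≡b = x , here refl , hx≡b
    ... | no  hx≢b =
      let v , v∈P , hv≡b = walk-crosses-level P (≤-trans (h-step a) (≤∧≢⇒< hx≤b hx≢b)) b≤hz
      in  v , there v∈P , hv≡b

    -- Every x,z-walk passes through the level of y; if y is alone on its level, it blocks x from z.
    alone-on-level-blocks : ∀ {S x y z} → IsMutualVisibilitySet G S → x ∈ S → y ∈ S → z ∈ S →
                            h x < h y → h y < h z → (∀ v → h v ≡ h y → v ≡ y) → ⊥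
    alone-on-level-blocks mv x∈S y∈S z∈S hx<hy hy<hz alone
      with P , _ , avoids ← mv _ _ x∈S z∈S
      with v , v∈P , hv≡hy ← walk-crosses-level P (<⇒≤ hx<hy) (<⇒≤ hy<hz)
      with refl ← alone v hv≡hy
      with avoids v v∈P y∈S
    ... | inj₁ refl = <-irrefl refl hx<hy
    ... | inj₂ refl = <-irrefl refl hy<hz

relationGraph : ∀ {n} (R : Fin n → Fin n → Set) → (∀ x y → Dec (R x y)) →
                (∀ {x y} → R x y → R y x) → (∀ x → ¬ R x x) → Graph n
relationGraph R R? R-sym R-irrefl = record
  { adj    = λ x y → does (R? x y)
  ; sym    = λ x y → does-⇔ (mk⇔ R-sym R-sym) (R? x y) (R? y x)
  ; irrefl = λ x → dec-false (R? x x) (R-irrefl x)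
  }

T-does : ∀ {A : Set} (a? : Dec A) → T (does a?) → A
T-does (yes a) _ = a

does-T : ∀ {A : Set} (a? : Dec A) → A → T (does a?)
does-T (yes _) _ = _
does-T (no ¬a) a = ¬a a

Near : ∀ {n} → (Fin n → ℕ) → Fin n → Fin n → Set
Near h u v = u ≢ v × h u ≤ suc (h v) × h v ≤ suc (h u)

module _ {n : ℕ} (h : Fin n → ℕ) where

  near? : ∀ u v → Dec (Near h u v)
  near? u v = ¬? (u Finₚ.≟ v) ×-dec (h u ≤? suc (h v)) ×-dec (h v ≤? suc (h u))

  heightGraph : Graph n
  heightGraph = relationGraph (Near h) near?
    (λ (u≢v , hu≤ , hv≤) → u≢v ∘ sym , hv≤ , hu≤)
    (λ _ (x≢x , _) → x≢x refl)

  Near⇒Adj : ∀ {u v} → Near h u v → Adj heightGraph u v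
  Near⇒Adj {u} {v} = does-T (near? u v)

  consecutive⇒Adj : ∀ {u v} → h u ≡ suc (h v) → Adj heightGraph u v
  consecutive⇒Adj {u} {v} hu≡1+hv = Near⇒Adj
    ( (λ { refl → 1+n≢n (sym hu≡1+hv) })
    , ≤-reflexive hu≡1+hv
    , ≤-trans (n≤1+n (h v)) (≤-trans (≤-reflexive (sym hu≡1+hv)) (n≤1+n (h u))) )

  heightGraph-step : ∀ {u v} → Adj heightGraph u v → h v ≤ suc (h u)
  heightGraph-step {u} {v} = proj₂ ∘ proj₂ ∘ T-does (near? u v)

⌊m/2⌋≡⌊n/2⌋⇒m≤1+n : ∀ m n → ⌊ m /2⌋ ≡ ⌊ n /2⌋ → m ≤ suc n
⌊m/2⌋≡⌊n/2⌋⇒m≤1+n zero          n             _ = z≤n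
⌊m/2⌋≡⌊n/2⌋⇒m≤1+n (suc zero)    n             _ = s≤s z≤n
⌊m/2⌋≡⌊n/2⌋⇒m≤1+n (suc (suc m)) (suc (suc n)) e =
  s≤s (s≤s (⌊m/2⌋≡⌊n/2⌋⇒m≤1+n m n (suc-injective e)))

k≤⌊n/2⌋⇒k+k≤n : ∀ {k} n → k ≤ ⌊ n /2⌋ → k + k ≤ n
k≤⌊n/2⌋⇒k+k≤n n k≤n/2 =
  ≤-trans (+-mono-≤ k≤n/2 (≤-trans k≤n/2 (⌊n/2⌋≤⌈n/2⌉ n))) (≤-reflexive (⌊n/2⌋+⌈n/2⌉≡n n))

Empty⇒∣p∣≡0 : ∀ {n} {p : Subset n} → Empty p → ∣ p ∣ ≡ 0
Empty⇒∣p∣≡0 {n} empty = trans (cong ∣_∣ (Empty-unique empty)) (∣⊥∣≡0 n)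

∣p++q∣≡∣p∣+∣q∣ : ∀ {m n} (p : Subset m) (q : Subset n) → ∣ p ++ q ∣ ≡ ∣ p ∣ + ∣ q ∣
∣p++q∣≡∣p∣+∣q∣ []            q = refl
∣p++q∣≡∣p∣+∣q∣ (inside  ∷ p) q = cong suc (∣p++q∣≡∣p∣+∣q∣ p q)
∣p++q∣≡∣p∣+∣q∣ (outside ∷ p) q = ∣p++q∣≡∣p∣+∣q∣ p q

x∈p⇒x↑ˡ∈p++q : ∀ {m n} {p : Subset m} {x} (q : Subset n) → x ∈ p → x ↑ˡ n ∈ p ++ q
x∈p⇒x↑ˡ∈p++q {p = p} {x} q x∈p = lookup⇒[]= _ _ (trans (lookup-++ˡ p q x) ([]=⇒lookup x∈p))

x∈q⇒m↑ʳx∈p++q : ∀ {m n} (p : Subset m) {q : Subset n} {x} → x ∈ q → m ↑ʳ x ∈ p ++ q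
x∈q⇒m↑ʳx∈p++q p {q} {x} x∈q = lookup⇒[]= _ _ (trans (lookup-++ʳ p q x) ([]=⇒lookup x∈q))

noIncreasingPair⇒∣p∣≤1 : ∀ {n} (p : Subset n) →
                         (∀ {x y} → x Fin.< y → x ∈ p → y ∈ p → ⊥) → ∣ p ∣ ≤ 1
noIncreasingPair⇒∣p∣≤1 []            _      = z≤n
noIncreasingPair⇒∣p∣≤1 (inside  ∷ p) noPair =
  s≤s (≤-reflexive (Empty⇒∣p∣≡0 λ (y , y∈p) → noPair z<s here (there y∈p)))
noIncreasingPair⇒∣p∣≤1 (outside ∷ p) noPair =
  noIncreasingPair⇒∣p∣≤1 p λ x<y x∈p y∈p → noPair (s<s x<y) (there x∈p) (there y∈p)

noIncreasingTriple⇒∣p∣≤2 : ∀ {n} (p : Subset n) →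
                           (∀ {x y z} → x Fin.< y → y Fin.< z → x ∈ p → y ∈ p → z ∈ p → ⊥) → ∣ p ∣ ≤ 2
noIncreasingTriple⇒∣p∣≤2 []            _        = z≤n
noIncreasingTriple⇒∣p∣≤2 (inside  ∷ p) noTriple =
  s≤s (noIncreasingPair⇒∣p∣≤1 p λ y<z y∈p z∈p → noTriple z<s (s<s y<z) here (there y∈p) (there z∈p))
noIncreasingTriple⇒∣p∣≤2 (outside ∷ p) noTriple =
  noIncreasingTriple⇒∣p∣≤2 p λ x<y y<z x∈p y∈p z∈p →
    noTriple (s<s x<y) (s<s y<z) (there x∈p) (there y∈p) (there z∈p)

indicator : ∀ {A : Set} → Dec A → Fin 2
indicator (yes _) = Fin.suc Fin.zero
indicator (no _)  = Fin.zero

indicator-yes : ∀ {A : Set} (a? : Dec A) → A → indicator a? ≡ Fin.suc Fin.zero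
indicator-yes (yes _) _ = refl
indicator-yes (no ¬a) a = contradiction a ¬a

indicator≡1⇒ : ∀ {A : Set} (a? : Dec A) → indicator a? ≡ Fin.suc Fin.zero → A
indicator≡1⇒ (yes a) _ = a

-- Tag each point with its colour and whether that colour occurred before it: two points
-- with equal tags p < q force q's tag bit, hence p's, hence an earlier third point r < p.
pigeonhole₃ : ∀ {m n} → m + m < n → (f : Fin n → Fin m) →
              ∃ λ r → ∃ λ p → ∃ λ q → r Fin.< p × p Fin.< q × f r ≡ f p × f p ≡ f q
pigeonhole₃ {m} {n} 2m<n f =
  let p , q , p<q , tag≡ = Finₚ.pigeonhole (subst (_< n) m+m≡m*2 2m<n) tag
      fp≡fq             = Finₚ.combine-injectiveˡ (f p) _ (f q) _ tag≡
      seen≡             = Finₚ.combine-injectiveʳ (f p) _ (f q) _ tag≡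
      r , r<p , fr≡fp   = indicator≡1⇒ (seenBefore? p)
                            (trans seen≡ (indicator-yes (seenBefore? q) (p , p<q , fp≡fq)))
  in  r , p , q , r<p , p<q , fr≡fp , fp≡fq
  where
  m+m≡m*2 : m + m ≡ m * 2
  m+m≡m*2 = trans (cong (m +_) (sym (+-identityʳ m))) (*-comm 2 m)

  seenBefore? : ∀ p → Dec (∃ λ r → r Fin.< p × f r ≡ f p)
  seenBefore? p = Finₚ.any? λ r → r Finₚ.<? p ×-dec f r Finₚ.≟ f p

  tag : Fin n → Fin (m * 2)
  tag p = combine (f p) (indicator (seenBefore? p))

⌈/⌉≤ : ∀ a b c → a ≤ c * suc b → ⌈ a / suc b ⌉ ≤ c
⌈/⌉≤ a b c a≤c*[1+b] = s≤s⁻¹ (m<n*o⇒m/o<n (begin-strict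
  a + b               <⟨ +-monoˡ-< b (s≤s a≤c*[1+b]) ⟩
  suc (c * suc b) + b ≡⟨ +-comm (suc (c * suc b)) b ⟩
  b + suc (c * suc b) ≡⟨ +-suc b (c * suc b) ⟩
  suc c * suc b       ∎))
  where open ≤-Reasoning

Realises : ℕ → ℕ → Set
Realises n k = Σ (Graph n) λ G → Connected G × Σ ℕ λ m → IsMu G m × ⌈ n / m ⌉ ≤ k × IsChiMu G k

atLeast : ∀ {t} a → Subset (suc a + t)
atLeast zero    = ⊤
atLeast (suc a) = outside ∷ atLeast a

∣atLeast∣ : ∀ {t} a → ∣ atLeast {t} a ∣ ≡ suc t
∣atLeast∣ {t} zero = ∣⊤∣≡n (suc t)
∣atLeast∣ (suc a)  = ∣atLeast∣ a

∈atLeast⇒≤ : ∀ {t} a {x : Fin (suc a + t)} → x ∈ atLeast a → a ≤ toℕ x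
∈atLeast⇒≤ zero    _             = z≤n
∈atLeast⇒≤ (suc a) (there x∈top) = s≤s (∈atLeast⇒≤ a x∈top)

-- Vertex i sits at height min(i, L): the vertices 0, …, L − 1 form a path and the t vertices
-- of height L a clique joined to L − 1.
module Lollipop (k′ o : ℕ) where

  k L t : ℕ
  k = suc k′
  L = suc (k′ + k′)
  t = suc o

  V : Set
  V = Fin (L + t)

  height : V → ℕ
  height v = toℕ v ⊓ L

  G : Graph (L + t)
  G = heightGraph height

  height≤L : ∀ v → height v ≤ L
  height≤L v = m⊓n≤n (toℕ v) L

  height<L⇒≡toℕ : ∀ v → height v < L → height v ≡ toℕ v
  height<L⇒≡toℕ v hv<L with ≤-total (toℕ v) L
  ... | inj₁ v≤L = m≤n⇒m⊓n≡m v≤L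
  ... | inj₂ L≤v = contradiction (m≥n⇒m⊓n≡n L≤v) (<⇒≢ hv<L)

  level-unique : ∀ u v → height u ≡ height v → height v < L → u ≡ v
  level-unique u v hu≡hv hv<L = Finₚ.toℕ-injective (begin
    toℕ u     ≡⟨ sym (height<L⇒≡toℕ u (subst (_< L) (sym hu≡hv) hv<L)) ⟩
    height u  ≡⟨ hu≡hv ⟩
    height v  ≡⟨ height<L⇒≡toℕ v hv<L ⟩
    toℕ v     ∎)
    where open ≡-Reasoning

  no-increasing-triple : ∀ {S x y z} → IsMutualVisibilitySet G S → x ∈ S → y ∈ S → z ∈ S →
             height x < height y → height y < height z → ⊥
  no-increasing-triple {y = y} {z} mv x∈S y∈S z∈S hx<hy hy<hz =
    alone-on-level-blocks G height (heightGraph-step height) mv x∈S y∈S z∈S hx<hy hy<hz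
      λ v hv≡hy → level-unique v y hv≡hy (<-≤-trans hy<hz (height≤L z))

  vertexAt : ∀ b → b ≤ L → V
  vertexAt b b≤L = fromℕ< (≤-<-trans b≤L (m<m+n L z<s))

  height-vertexAt : ∀ b b≤L → height (vertexAt b b≤L) ≡ b
  height-vertexAt b b≤L = trans (cong (_⊓ L) toℕ-v) (m≤n⇒m⊓n≡m b≤L)
    where toℕ-v = Finₚ.toℕ-fromℕ< (≤-<-trans b≤L (m<m+n L z<s))

  descend : ∀ b v → height v ≡ b → Walk G v Fin.zero
  descend zero v hv≡0 with refl ← level-unique v Fin.zero hv≡0 z<s = [ v ]
  descend (suc b) v hv≡1+b =
    consecutive⇒Adj height (trans hv≡1+b (cong suc (sym hw≡b))) ∷ᵂ descend b w hw≡b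
    where
    b<L  = subst (_≤ L) hv≡1+b (height≤L v)
    w    = vertexAt b (<⇒≤ b<L)
    hw≡b = height-vertexAt b (<⇒≤ b<L)

  height-↑ˡ : ∀ (x : Fin L) → height (x ↑ˡ t) ≡ toℕ x
  height-↑ˡ x = trans (cong (_⊓ L) (Finₚ.toℕ-↑ˡ x t)) (m≤n⇒m⊓n≡m (<⇒≤ (Finₚ.toℕ<n x)))

  height-↑ʳ : ∀ (q : Fin t) → height (L ↑ʳ q) ≡ L
  height-↑ʳ q = m≥n⇒m⊓n≡n (subst (L ≤_) (sym (Finₚ.toℕ-↑ʳ L q)) (m≤m+n L (toℕ q)))

  along-path : ∀ {x y : Fin L} → x Fin.< y → height (x ↑ˡ t) < height (y ↑ˡ t)
  along-path = subst₂ _<_ (sym (height-↑ˡ _)) (sym (height-↑ˡ _))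

  path-below-top : ∀ (x : Fin L) q → height (x ↑ˡ t) < height (L ↑ʳ q)
  path-below-top x q = subst₂ _<_ (sym (height-↑ˡ x)) (sym (height-↑ʳ q)) (Finₚ.toℕ<n x)

  mutualVisibility⇒∣S∣≤1+t : ∀ {S} → IsMutualVisibilitySet G S → ∣ S ∣ ≤ suc t
  mutualVisibility⇒∣S∣≤1+t {S} mv with A , C , refl ← Vec.splitAt L S
    rewrite ∣p++q∣≡∣p∣+∣q∣ A C with nonempty? C
  ... | yes (q , q∈C) = +-mono-≤ (noIncreasingPair⇒∣p∣≤1 A λ x<y x∈A y∈A →
          no-increasing-triple mv (x∈p⇒x↑ˡ∈p++q C x∈A) (x∈p⇒x↑ˡ∈p++q C y∈A) (x∈q⇒m↑ʳx∈p++q A q∈C)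
            (along-path x<y) (path-below-top _ q))
        (∣p∣≤n C)
  ... | no C-empty = ≤-trans (+-mono-≤ (noIncreasingTriple⇒∣p∣≤2 A λ x<y y<z x∈A y∈A z∈A →
          no-increasing-triple mv (x∈p⇒x↑ˡ∈p++q C x∈A) (x∈p⇒x↑ˡ∈p++q C y∈A) (x∈p⇒x↑ˡ∈p++q C z∈A)
            (along-path x<y) (along-path y<z))
        (≤-reflexive (Empty⇒∣p∣≡0 C-empty))) (s≤s (s≤s z≤n))

  top-clique : Clique G (atLeast (k′ + k′))
  top-clique {x} {y} x∈top y∈top x≢y = Near⇒Adj height (x≢y , high y∈top x∈top , high x∈top y∈top)
    where
    high : ∀ {u v} → u ∈ atLeast (k′ + k′) → v ∈ atLeast (k′ + k′) → height v ≤ suc (height u)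
    high {u} {v} u∈top _ = ≤-trans (height≤L v) (s≤s (⊓-glb (∈atLeast⇒≤ (k′ + k′) u∈top) (n≤1+n _)))

  isMu : IsMu G (suc t)
  isMu = (atLeast (k′ + k′) , clique⇒mutualVisibility G top-clique , ∣atLeast∣ (k′ + k′))
       , λ _ → mutualVisibility⇒∣S∣≤1+t

  colour-bound : ∀ v → ⌊ height v /2⌋ < k
  colour-bound v = s≤s (≤-trans (⌊n/2⌋-mono (height≤L v)) (≤-reflexive (sym (n≡⌈n+n/2⌉ k′))))

  colour : V → Fin k
  colour v = fromℕ< (colour-bound v)

  toℕ-colour : ∀ v → toℕ (colour v) ≡ ⌊ height v /2⌋
  toℕ-colour v = Finₚ.toℕ-fromℕ< (colour-bound v)

  sameColour⇒Adj : ∀ {u v} → colour u ≡ colour v → u ≢ v → Adj G u v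
  sameColour⇒Adj {u} {v} cu≡cv u≢v = Near⇒Adj height
    (u≢v , ⌊m/2⌋≡⌊n/2⌋⇒m≤1+n _ _ halves≡ , ⌊m/2⌋≡⌊n/2⌋⇒m≤1+n _ _ (sym halves≡))
    where halves≡ = trans (sym (toℕ-colour u)) (trans (cong toℕ cu≡cv) (toℕ-colour v))

  colour-isMVColouring : IsMVColouring G colour
  colour-isMVColouring i = clique⇒mutualVisibility G λ x∈ y∈ →
    sameColour⇒Adj (trans (∈colourClass⇒ G colour x∈) (sym (∈colourClass⇒ G colour y∈)))

  colour-surjective : Surjective _≡_ _≡_ colour
  colour-surjective i = vertexAt (toℕ i + toℕ i) 2i≤L , λ { refl → Finₚ.toℕ-injective (begin
      toℕ (colour (vertexAt (toℕ i + toℕ i) 2i≤L)) ≡⟨ toℕ-colour _ ⟩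
      ⌊ height (vertexAt (toℕ i + toℕ i) 2i≤L) /2⌋ ≡⟨ cong ⌊_/2⌋ (height-vertexAt _ 2i≤L) ⟩
      ⌊ toℕ i + toℕ i /2⌋                          ≡⟨ sym (n≡⌊n+n/2⌋ (toℕ i)) ⟩
      toℕ i                                        ∎) }
    where
    open ≡-Reasoning
    i≤k′ = s≤s⁻¹ (Finₚ.toℕ<n i)
    2i≤L = m≤n⇒m≤1+n (+-mono-≤ i≤k′ i≤k′)

  fewerColours⇒¬isMVColouring : ∀ j → j < k → (c : V → Fin j) → ¬ IsMVColouring G c
  fewerColours⇒¬isMVColouring j (s≤s j≤k′) c mv =
    let r , p , q , r<p , p<q , cr≡cp , cp≡cq =
          pigeonhole₃ (s≤s (m≤n⇒m≤1+n (+-mono-≤ j≤k′ j≤k′))) (c ∘ spine)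
    in  no-increasing-triple (mv (c (spine q)))
          (⇒∈colourClass G c (trans cr≡cp cp≡cq)) (⇒∈colourClass G c cp≡cq) (⇒∈colourClass G c refl)
          (spine-increasing r<p) (spine-increasing p<q)
    where
    below : ∀ (i : Fin (suc L)) → toℕ i ≤ L
    below i = s≤s⁻¹ (Finₚ.toℕ<n i)
    spine : Fin (suc L) → V
    spine i = vertexAt (toℕ i) (below i)
    spine-increasing : ∀ {i j} → i Fin.< j → height (spine i) < height (spine j)
    spine-increasing {i} {j} =
      subst₂ _<_ (sym (height-vertexAt (toℕ i) (below i))) (sym (height-vertexAt (toℕ j) (below j)))

  order≤k*μ : L + t ≤ k * suc t
  order≤k*μ = begin
    suc (k′ + k′) + t     ≡⟨ sym (+-suc (k′ + k′) t) ⟩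
    k′ + k′ + suc t       ≡⟨ +-comm (k′ + k′) (suc t) ⟩
    suc t + (k′ + k′)     ≤⟨ +-monoʳ-≤ (suc t) (+-monoʳ-≤ k′ (m≤m*n k′ t)) ⟩
    suc t + (k′ + k′ * t) ≡⟨ cong (suc t +_) (sym (*-suc k′ t)) ⟩
    k * suc t             ∎
    where open ≤-Reasoning

  realises : Realises (L + t) k
  realises = G , reachAll⇒Connected G Fin.zero (λ v → descend (height v) v refl)
           , suc t , isMu , ⌈/⌉≤ (L + t) t k order≤k*μ
           , (colour , colour-surjective , colour-isMVColouring) , fewerColours⇒¬isMVColouring

realisable : ∀ {n k} → 1 ≤ k → k + k ≤ n → Realises n k
realisable {k = suc k′} (s≤s z≤n) 2k≤n with o , refl ← m≤n⇒∃[o]m+o≡n 2k≤n =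
  subst (λ N → Realises N (suc k′)) order≡ (Lollipop.realises k′ o)
  where
  order≡ : suc (k′ + k′) + suc o ≡ suc k′ + suc k′ + o
  order≡ = cong suc (trans (+-suc (k′ + k′) o) (cong (_+ o) (sym (+-suc k′ k′))))

proposition5p7 : (n k : ℕ) → 2 ≤ k → k ≤ ⌊ n /2⌋ →
    Σ (Graph n) λ G → Connected G ×
      Σ ℕ λ m → IsMu G m × ⌈ n / m ⌉ ≤ k × IsChiMu G k × k ≤ ⌊ n /2⌋
proposition5p7 n k 2≤k k≤n/2
  with G , connected , m , isMu , ⌈n/m⌉≤k , isChiMu
         ← realisable (<⇒≤ 2≤k) (k≤⌊n/2⌋⇒k+k≤n n k≤n/2)
  = G , connected , m , isMu , ⌈n/m⌉≤k , isChiMu , k≤n/2
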